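{- Let $\omega$ be a permutation of $[n]$, and let $\mathcal{C}^0$ be the collection consisting of $\emptyset$ together with all sets $I^k_\omega\cap[j..n]$ for $1\le k\le n$, $1\le j\le\omega^{ -1}(k)$. Let $X\subset[n]$ satisfy $X\notin\mathcal{C}^0$ and be weakly separated from every member of $\mathcal{C}^0$; let $k=|X|$ and $Y=I^k_\omega$. Then $X\rhd Y$ does not hold.
   Context: $[j..n]=\{j,\dots,n\}$, $I^k_\omega=\{i:\omega(i)\le k\}$, $I^0_\omega=\emptyset$. For $A,B\subseteq[n]$ write $A\lessdot B$ if $B-A\neq\emptyset$ and $i<j$ for all $i\in A-B$, $j\in B-A$. Write $A\rhd B$ if both $A-B$ and $B-A$ are nonempty and $B-A$ is a disjoint union $B'\sqcup B''$ of nonempty sets with $b'<a<b''$ for all $b'\in B'$, $a\in A-B$, $b''\in B''$. Sets $A,B$ are weakly separated if $A\lessdot B$, or $B\lessdot A$, or ($A\rhd B$ and $|A|\ge|B|$), or ($B\rhd A$ and $|B|\ge|A|$), or $A=B$. -}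

module Defs where

open import Data.Nat using (ℕ; suc; _≤_; _≥_; _≤?_)
open import Data.Fin using (Fin; toℕ; _<_)
open import Data.Fin.Subset using (Subset; _∈_; _∩_; _∪_; ∁; ⊥; ∣_∣; Nonempty; Empty)
open import Data.Fin.Permutation using (Permutation′; _⟨$⟩ʳ_; _⟨$⟩ˡ_)
open import Data.Vec using (tabulate)
open import Data.Product using (Σ; _×_; ∃)
open import Data.Sum using (_⊎_)
open import Relation.Nullary using (does)
open import Relation.Binary.PropositionalEquality using (_≡_)

-- Convention: the ground set [n] = {1,…,n} is represented by Fin n,
-- element i : Fin n standing for the number toℕ i + 1 (order preserved).
-- A permutation ω of [n] is a Permutation′ n; the 1-indexed value ω(i)
-- is suc (toℕ (ω ⟨$⟩ʳ i)).

_∖_ : ∀ {n} → Subset n → Subset n → Subset n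
A ∖ B = A ∩ ∁ B

I : ∀ {n} → Permutation′ n → ℕ → Subset n
I ω k = tabulate (λ i → does (suc (toℕ (ω ⟨$⟩ʳ i)) ≤? k))

interval : ∀ {n} → ℕ → Subset n
interval j = tabulate (λ i → does (j ≤? suc (toℕ i)))

_⋖_ : ∀ {n} → Subset n → Subset n → Set
A ⋖ B = Nonempty (B ∖ A) × (∀ i j → i ∈ (A ∖ B) → j ∈ (B ∖ A) → i < j)

_▷_ : ∀ {n} → Subset n → Subset n → Set
A ▷ B = Nonempty (A ∖ B) × Nonempty (B ∖ A) ×
  Σ _ λ B′ → Σ _ λ B″ →
    (B ∖ A ≡ B′ ∪ B″) × Empty (B′ ∩ B″) × Nonempty B′ × Nonempty B″ ×
    (∀ b′ a b″ → b′ ∈ B′ → a ∈ (A ∖ B) → b″ ∈ B″ → (b′ < a) × (a < b″))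

WeaklySeparated : ∀ {n} → Subset n → Subset n → Set
WeaklySeparated A B =
  (A ⋖ B) ⊎ (B ⋖ A) ⊎ ((A ▷ B) × ∣ A ∣ ≥ ∣ B ∣) ⊎ ((B ▷ A) × ∣ B ∣ ≥ ∣ A ∣) ⊎ (A ≡ B)

-- 𝒞⁰: ∅ together with I^k_ω ∩ [j..n] for 1 ≤ k ≤ n, 1 ≤ j ≤ ω⁻¹(k).
-- k ranges over Fin n with 1-indexed value suc (toℕ k); ω⁻¹(k) is then
-- suc (toℕ (ω ⟨$⟩ˡ k)).
C0 : ∀ {n} → Permutation′ n → Subset n → Set
C0 {n} ω S = (S ≡ ⊥) ⊎
  Σ (Fin n) λ k → Σ ℕ λ j →
    (1 ≤ j) × (j ≤ suc (toℕ (ω ⟨$⟩ˡ k))) × (S ≡ I ω (suc (toℕ k)) ∩ interval j)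

module Submission where

-- Let X ▷ Y with Y = I^k_ω and k = |X|.  The proof shows that X then fails to
-- be weakly separated from the member B = I^{k+1}_ω ∩ [1..n] of 𝒞⁰.
--
-- The core is a statement about arbitrary subsets (`▷-obstructs-superset`):
-- if X ▷ Y then X is not weakly separated from any B ⊇ Y with |B| = |X| + 1.
-- Indeed X ▷ Y provides y′ < y″ in Y − X sandwiching all of X − Y.  Both lie in
-- B − X, so counting forces some x₀ ∈ X − B (`▷-escapes-superset`); as
-- X − B ⊆ X − Y we get y′ < x₀ < y″, which rules out X ⋖ B, B ⋖ X, B ▷ X and
-- X = B, while X ▷ B is excluded because |X| < |B|.
--
-- To apply this we show |I^m_ω| = m for m ≤ n (`∣I∣≡`): passing from I^m to
-- I^{m+1} adds exactly the element ω⁻¹(m+1).  Since X − Y is nonempty, some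
-- a ∈ X has ω(a) > k, so k < n and B = I^{k+1}_ω has size k + 1.

open import Defs
open import Data.Nat as ℕ using (ℕ; zero; suc; z≤n; s≤s; _≤?_)
import Data.Nat.Properties as ℕₚ
open import Data.Fin using (Fin; zero; suc; toℕ; fromℕ<; _<_)
import Data.Fin.Properties as Finₚ
open import Data.Fin.Subset
  using (Subset; ∣_∣; _∈_; _∉_; _∩_; ∁; ⊥; _-_; _⊆_; Nonempty; inside; outside)
open import Data.Fin.Subset.Properties
open import Data.Fin.Permutation using (Permutation′; _⟨$⟩ʳ_; _⟨$⟩ˡ_; inverseˡ; inverseʳ)
open import Data.Vec using (_∷_; tabulate; here; there)
open import Data.Vec.Properties using (lookup∘tabulate; lookup⇒[]=; []=⇒lookup)
open import Data.Product using (_,_; _×_; proj₁; proj₂)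
open import Data.Sum using (inj₁; inj₂)
open import Data.Empty using (⊥-elim)
open import Function using (_∘_)
open import Relation.Nullary using (¬_; yes; no; does; contradiction)
open import Relation.Nullary.Decidable using (dec-true)
open import Relation.Unary using (Pred; Decidable)
open import Relation.Binary.PropositionalEquality

module _ {n p} {P : Pred (Fin n) p} (P? : Decidable P) where

  ∈-decided⁺ : ∀ {i} → P i → i ∈ tabulate (does ∘ P?)
  ∈-decided⁺ {i} Pi = lookup⇒[]= i _ (trans (lookup∘tabulate _ i) (dec-true (P? i) Pi))

  ∈-decided⁻ : ∀ {i} → i ∈ tabulate (does ∘ P?) → P i
  ∈-decided⁻ {i} i∈ with P? i | trans (sym (lookup∘tabulate (does ∘ P?) i)) ([]=⇒lookup i∈)
  ... | yes Pi | _  = Pi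
  ... | no _   | ()

∣p∣≤1+∣p-x∣ : ∀ {n} (p : Subset n) x → ∣ p ∣ ℕ.≤ suc ∣ p - x ∣
∣p∣≤1+∣p-x∣ (outside ∷ p) zero    = ℕₚ.m≤n⇒m≤1+n (ℕₚ.≤-reflexive (cong ∣_∣ (sym (p─⊥≡p p))))
∣p∣≤1+∣p-x∣ (inside  ∷ p) zero    = s≤s (ℕₚ.≤-reflexive (cong ∣_∣ (sym (p─⊥≡p p))))
∣p∣≤1+∣p-x∣ (outside ∷ p) (suc x) = ∣p∣≤1+∣p-x∣ p x
∣p∣≤1+∣p-x∣ (inside  ∷ p) (suc x) = s≤s (∣p∣≤1+∣p-x∣ p x)

x∉p-x : ∀ {n} (p : Subset n) x → x ∉ p - x
x∉p-x (_ ∷ p) zero    ()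
x∉p-x (_ ∷ p) (suc x) (there x∈p-x) = x∉p-x p x x∈p-x

∣p∣≡1+∣p-x∣ : ∀ {n} {p : Subset n} {x} → x ∈ p → ∣ p ∣ ≡ suc ∣ p - x ∣
∣p∣≡1+∣p-x∣ {p = p} {x} x∈p = ℕₚ.≤-antisym (∣p∣≤1+∣p-x∣ p x) (x∈p⇒∣p-x∣<∣p∣ x∈p)

∖⁻ : ∀ {n} {A B : Subset n} {x} → x ∈ A ∖ B → x ∈ A × x ∉ B
∖⁻ {A = A} {B} x∈ = let (x∈A , x∉B) = x∈p∩q⁻ A (∁ B) x∈ in x∈A , x∈∁p⇒x∉p x∉B

∖⁺ : ∀ {n} {A B : Subset n} {x} → x ∈ A → x ∉ B → x ∈ A ∖ B
∖⁺ x∈A x∉B = x∈p∩q⁺ (x∈A , x∉p⇒x∈∁p x∉B)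

∖-monoˡ : ∀ {n} {A B C : Subset n} → A ⊆ B → A ∖ C ⊆ B ∖ C
∖-monoˡ A⊆B x∈ = let (x∈A , x∉C) = ∖⁻ x∈ in ∖⁺ (A⊆B x∈A) x∉C

∖-antimonoʳ : ∀ {n} {A B C : Subset n} → B ⊆ C → A ∖ C ⊆ A ∖ B
∖-antimonoʳ B⊆C x∈ = let (x∈A , x∉C) = ∖⁻ x∈ in ∖⁺ x∈A (x∉C ∘ B⊆C)

record Sandwich {n} (A B : Subset n) : Set where
  field
    a        : Fin n
    a∈       : a ∈ A ∖ B
    b′ b″    : Fin n
    b′∈      : b′ ∈ B ∖ A
    b″∈      : b″ ∈ B ∖ A
    sandwiches : ∀ {x} → x ∈ A ∖ B → b′ < x × x < b″

  b′<b″ : b′ < b″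
  b′<b″ = let (b′<a , a<b″) = sandwiches a∈ in Finₚ.<-trans b′<a a<b″

▷-sandwich : ∀ {n} {A B : Subset n} → A ▷ B → Sandwich A B
▷-sandwich ((a , a∈) , _ , B′ , B″ , B∖A≡ , _ , (b′ , b′∈B′) , (b″ , b″∈B″) , order) = record
  { a = a ; a∈ = a∈ ; b′ = b′ ; b″ = b″
  ; b′∈ = subst (b′ ∈_) (sym B∖A≡) (x∈p∪q⁺ (inj₁ b′∈B′))
  ; b″∈ = subst (b″ ∈_) (sym B∖A≡) (x∈p∪q⁺ (inj₂ b″∈B″))
  ; sandwiches = λ {x} x∈ → order b′ x b″ b′∈B′ x∈ b″∈B″
  }

misses-two : ∀ {n} {X B : Subset n} {y z} → X ⊆ B →
  y ∈ B ∖ X → z ∈ B ∖ X → y ≢ z → suc (suc ∣ X ∣) ℕ.≤ ∣ B ∣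
misses-two {X = X} {B} {y} {z} X⊆B y∈ z∈ y≢z = begin
  suc (suc ∣ X ∣)         ≤⟨ s≤s (s≤s (p⊆q⇒∣p∣≤∣q∣ X⊆B-y-z)) ⟩
  suc (suc ∣ B - y - z ∣) ≤⟨ s≤s (x∈p⇒∣p-x∣<∣p∣ z∈B-y) ⟩
  suc ∣ B - y ∣           ≤⟨ x∈p⇒∣p-x∣<∣p∣ (proj₁ (∖⁻ y∈)) ⟩
  ∣ B ∣                   ∎
  where
  open ℕₚ.≤-Reasoning
  z∈B-y : z ∈ B - y
  z∈B-y = x∈p∧x≢y⇒x∈p-y (proj₁ (∖⁻ z∈)) (y≢z ∘ sym)
  X⊆B-y-z : X ⊆ B - y - z
  X⊆B-y-z {x} x∈X = x∈p∧x≢y⇒x∈p-y (x∈p∧x≢y⇒x∈p-y (X⊆B x∈X) (avoids y∈)) (avoids z∈)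
    where
    avoids : ∀ {w} → w ∈ B ∖ X → x ≢ w
    avoids w∈ refl = proj₂ (∖⁻ w∈) x∈X

-- If X ▷ Y and B ⊇ Y has at most |X| + 1 elements, then X ⊄ B: otherwise X
-- would lie in B minus the two sandwiching elements of Y − X.
▷-escapes-superset : ∀ {n} {X Y B : Subset n} → X ▷ Y → Y ⊆ B →
  ∣ B ∣ ℕ.≤ suc ∣ X ∣ → Nonempty (X ∖ B)
▷-escapes-superset {X = X} {B = B} X▷Y Y⊆B ∣B∣≤ with nonempty? (X ∖ B)
... | yes X∖B≠∅ = X∖B≠∅
... | no  X∖B=∅ = contradiction (ℕₚ.≤-trans ∣X∣+2≤∣B∣ ∣B∣≤) (ℕₚ.n≮n (suc ∣ X ∣))
  where
  open Sandwich (▷-sandwich X▷Y) using (b′∈; b″∈; b′<b″)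
  X⊆B : X ⊆ B
  X⊆B {x} x∈X with x ∈? B
  ... | yes x∈B = x∈B
  ... | no  x∉B = ⊥-elim (X∖B=∅ (x , ∖⁺ x∈X x∉B))
  ∣X∣+2≤∣B∣ : suc (suc ∣ X ∣) ℕ.≤ ∣ B ∣
  ∣X∣+2≤∣B∣ = misses-two X⊆B (∖-monoˡ Y⊆B b′∈) (∖-monoˡ Y⊆B b″∈) (Finₚ.<⇒≢ b′<b″)

▷-obstructs-superset : ∀ {n} {X Y B : Subset n} → X ▷ Y → Y ⊆ B →
  ∣ B ∣ ≡ suc ∣ X ∣ → ¬ WeaklySeparated X B
▷-obstructs-superset {X = X} {Y} {B} X▷Y Y⊆B ∣B∣≡ =
  excluded (▷-escapes-superset X▷Y Y⊆B (ℕₚ.≤-reflexive ∣B∣≡))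
  where
  open Sandwich (▷-sandwich X▷Y) using (b′; b″; b′∈; b″∈; sandwiches)
  sandwiched : ∀ {x} → x ∈ X ∖ B → b′ < x × x < b″
  sandwiched = sandwiches ∘ ∖-antimonoʳ Y⊆B
  b′∈B∖X : b′ ∈ B ∖ X
  b′∈B∖X = ∖-monoˡ Y⊆B b′∈
  b″∈B∖X : b″ ∈ B ∖ X
  b″∈B∖X = ∖-monoˡ Y⊆B b″∈

  excluded : Nonempty (X ∖ B) → ¬ WeaklySeparated X B
  excluded (x₀ , x₀∈) (inj₁ (_ , X<B)) =
    Finₚ.<-asym (X<B x₀ b′ x₀∈ b′∈B∖X) (proj₁ (sandwiched x₀∈))
  excluded (x₀ , x₀∈) (inj₂ (inj₁ (_ , B<X))) =
    Finₚ.<-asym (B<X b″ x₀ b″∈B∖X x₀∈) (proj₂ (sandwiched x₀∈))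
  excluded _ (inj₂ (inj₂ (inj₁ (_ , ∣X∣≥∣B∣)))) =
    contradiction (subst (ℕ._≤ ∣ X ∣) ∣B∣≡ ∣X∣≥∣B∣) (ℕₚ.n≮n ∣ X ∣)
  excluded _ (inj₂ (inj₂ (inj₂ (inj₁ (B▷X , _))))) =
    -- B ▷ X puts some c ∈ X − B below b′ ∈ B − X, yet c is sandwiched above b′
    let open Sandwich (▷-sandwich B▷X) renaming (b′ to c; b′∈ to c∈; sandwiches to c-sandwiches)
    in Finₚ.<-asym (proj₁ (c-sandwiches b′∈B∖X)) (proj₁ (sandwiched c∈))
  excluded (x₀ , x₀∈) (inj₂ (inj₂ (inj₂ (inj₂ X≡B)))) =
    let (x₀∈X , x₀∉B) = ∖⁻ x₀∈ in x₀∉B (subst (x₀ ∈_) X≡B x₀∈X)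

module _ {n} (ω : Permutation′ n) where

  ∈I⁺ : ∀ {m i} → suc (toℕ (ω ⟨$⟩ʳ i)) ℕ.≤ m → i ∈ I ω m
  ∈I⁺ {m} = ∈-decided⁺ (λ i → suc (toℕ (ω ⟨$⟩ʳ i)) ≤? m)

  ∈I⁻ : ∀ {m i} → i ∈ I ω m → suc (toℕ (ω ⟨$⟩ʳ i)) ℕ.≤ m
  ∈I⁻ {m} = ∈-decided⁻ (λ i → suc (toℕ (ω ⟨$⟩ʳ i)) ≤? m)

  I-mono : ∀ {m m′} → m ℕ.≤ m′ → I ω m ⊆ I ω m′
  I-mono m≤m′ i∈ = ∈I⁺ (ℕₚ.≤-trans (∈I⁻ i∈) m≤m′)

  I-zero : I ω 0 ≡ ⊥
  I-zero = ⊆-antisym (λ i∈ → contradiction (∈I⁻ {0} i∈) λ ()) ⊥⊆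

  ∉I⇒<n : ∀ {m i} → i ∉ I ω m → m ℕ.< n
  ∉I⇒<n {i = i} i∉ =
    ℕₚ.≤-<-trans (ℕₚ.≤-pred (ℕₚ.≰⇒> (i∉ ∘ ∈I⁺))) (Finₚ.toℕ<n (ω ⟨$⟩ʳ i))

  module _ {m} (m<n : m ℕ.< n) where

    new : Fin n
    new = ω ⟨$⟩ˡ fromℕ< m<n

    ω-new : toℕ (ω ⟨$⟩ʳ new) ≡ m
    ω-new = trans (cong toℕ (inverseʳ ω)) (Finₚ.toℕ-fromℕ< m<n)

    new∈I : new ∈ I ω (suc m)
    new∈I = ∈I⁺ (ℕₚ.≤-reflexive (cong suc ω-new))

    I-suc : I ω (suc m) - new ≡ I ω m
    I-suc = ⊆-antisym shrink grow
      where
      shrink : I ω (suc m) - new ⊆ I ω m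
      shrink {i} i∈ with ℕₚ.m≤n⇒m<n∨m≡n (ℕₚ.≤-pred (∈I⁻ (p─q⊆p _ _ i∈)))
      ... | inj₁ ω-i<m = ∈I⁺ ω-i<m
      ... | inj₂ ω-i≡m = contradiction (subst (_∈ _) i≡new i∈) (x∉p-x _ new)
        where
        i≡new : i ≡ new
        i≡new = trans (sym (inverseˡ ω))
                  (cong (ω ⟨$⟩ˡ_) (Finₚ.toℕ-injective (trans ω-i≡m (sym (Finₚ.toℕ-fromℕ< m<n)))))
      grow : I ω m ⊆ I ω (suc m) - new
      grow i∈ = x∈p∧x≢y⇒x∈p-y (I-mono (ℕₚ.n≤1+n m) i∈)
        λ { refl → ℕₚ.<-irrefl ω-new (∈I⁻ i∈) }

  ∣I∣≡ : ∀ m → m ℕ.≤ n → ∣ I ω m ∣ ≡ m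
  ∣I∣≡ zero    _   = trans (cong ∣_∣ I-zero) (∣⊥∣≡0 n)
  ∣I∣≡ (suc m) m<n = begin
    ∣ I ω (suc m) ∣               ≡⟨ ∣p∣≡1+∣p-x∣ (new∈I m<n) ⟩
    suc ∣ I ω (suc m) - new m<n ∣ ≡⟨ cong (suc ∘ ∣_∣) (I-suc m<n) ⟩
    suc ∣ I ω m ∣                 ≡⟨ cong suc (∣I∣≡ m (ℕₚ.<⇒≤ m<n)) ⟩
    suc m                         ∎
    where open ≡-Reasoning

∩-interval-1 : ∀ {n} (p : Subset n) → p ∩ interval 1 ≡ p
∩-interval-1 p = ⊆-antisym (p∩q⊆p p _)
  (λ i∈ → x∈p∩q⁺ (i∈ , ∈-decided⁺ (λ i → 1 ≤? suc (toℕ i)) (s≤s z≤n)))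

lemma2p3 : (n : ℕ) (ω : Permutation′ n) (X : Subset n) →
    ¬ C0 ω X →
    (∀ S → C0 ω S → WeaklySeparated X S) →
    ¬ (X ▷ I ω ∣ X ∣)
lemma2p3 n ω X _ separated X▷Y =
  ▷-obstructs-superset X▷Y Y⊆B ∣B∣≡ (separated B B∈𝒞⁰)
  where
  open Sandwich (▷-sandwich X▷Y) using (a∈)
  k : ℕ
  k = ∣ X ∣
  k<n : k ℕ.< n
  k<n = ∉I⇒<n ω (proj₂ (∖⁻ a∈))
  B : Subset n
  B = I ω (suc k) ∩ interval 1
  B∈𝒞⁰ : C0 ω B
  B∈𝒞⁰ = inj₂ (fromℕ< k<n , 1 , s≤s z≤n , s≤s z≤n ,
    cong (λ t → I ω (suc t) ∩ interval 1) (sym (Finₚ.toℕ-fromℕ< k<n)))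
  Y⊆B : I ω k ⊆ B
  Y⊆B = subst (I ω k ⊆_) (sym (∩-interval-1 (I ω (suc k)))) (I-mono ω (ℕₚ.n≤1+n k))
  ∣B∣≡ : ∣ B ∣ ≡ suc k
  ∣B∣≡ = trans (cong ∣_∣ (∩-interval-1 (I ω (suc k)))) (∣I∣≡ ω (suc k) k<n)
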